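{- Let $\vec G$ be an oriented graph having an arc $(u,v)$ such that $u$ is a source and $v$ is a sink. If $\vec G_0$ is obtained from $\vec G$ by replacing the arc $(u,v)$ with $(v,u)$, then $\operatorname{th}(\vec G_0)\le\operatorname{th}(\vec G)$.
   Context: An oriented graph is a simple digraph with no pair of opposite arcs. A source has in-degree $0$, a sink has out-degree $0$. Zero forcing: vertices are blue or white; a blue vertex $u$ with exactly one white out-neighbor $w$ may force $w$ ($u\to w$), turning it blue. A set $\mathcal F$ of forces is a set of forces of $B\subseteq V$ if, starting with exactly $B$ blue, the forces in $\mathcal F$ can be validly performed in some order after which no further force is possible. Put $\mathcal F^{[0]}=B$ and $\mathcal F^{[t+1]}=\mathcal F^{[t]}\cup\{w\notin\mathcal F^{[t]}:(u\to w)\in\mathcal F,\ u\in\mathcal F^{[t]},\ w$ the only out-neighbor of $u$ outside $\mathcal F^{[t]}\}$; $\operatorname{pt}(\Gamma;\mathcal F)$ is the least $t$ with $\mathcal F^{[t]}=V$ ($\infty$ if none); $\operatorname{pt}(\Gamma;B)=\min_{\mathcal F}\operatorname{pt}(\Gamma;\mathcal F)$; $\operatorname{th}(\Gamma)=\min_{B\subseteq V}(|B|+\operatorname{pt}(\Gamma;B))$. -}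

module Defs where

open import Data.Nat using (ℕ; zero; suc; _+_; _≤_; _<_)
open import Data.Fin using (Fin; _≟_)
open import Data.Fin.Subset using (Subset; _∈_; _∉_; _∪_; ⁅_⁆; ∣_∣)
open import Data.Bool using (Bool; true; false; if_then_else_; _∧_)
open import Data.List using (List; []; _∷_)
open import Data.List.Membership.Propositional using () renaming (_∈_ to _∈ₗ_)
open import Data.Product using (Σ; _×_; _,_; ∃; ∃-syntax)
open import Data.Sum using (_⊎_)
open import Data.Unit using (⊤)
open import Relation.Nullary using (¬_; does)
open import Relation.Binary.PropositionalEquality using (_≡_)

Digraph : ℕ → Set
Digraph n = Fin n → Fin n → Bool

Oriented : ∀ {n} → Digraph n → Set
Oriented {n} G = (∀ (x : Fin n) → G x x ≡ false)
               × (∀ (x y : Fin n) → G x y ≡ true → G y x ≡ false)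

Source : ∀ {n} → Digraph n → Fin n → Set
Source {n} G u = ∀ (w : Fin n) → G w u ≡ false

Sink : ∀ {n} → Digraph n → Fin n → Set
Sink {n} G v = ∀ (w : Fin n) → G v w ≡ false

reverseArc : ∀ {n} → Digraph n → Fin n → Fin n → Digraph n
reverseArc G u v x y =
  if does (x ≟ u) ∧ does (y ≟ v) then false
  else if does (x ≟ v) ∧ does (y ≟ u) then true
  else G x y

CanForce : ∀ {n} → Digraph n → Subset n → Fin n → Fin n → Set
CanForce {n} G S x w =
  x ∈ S × w ∉ S × G x w ≡ true
  × (∀ (y : Fin n) → G x y ≡ true → y ∉ S → y ≡ w)

Force : ℕ → Set
Force n = Fin n × Fin n

perform : ∀ {n} → Subset n → List (Force n) → Subset n
perform S [] = S
perform S ((x , w) ∷ fs) = perform (S ∪ ⁅ w ⁆) fs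

ValidSeq : ∀ {n} → Digraph n → Subset n → List (Force n) → Set
ValidSeq G S [] = ⊤
ValidSeq G S ((x , w) ∷ fs) = CanForce G S x w × ValidSeq G (S ∪ ⁅ w ⁆) fs

Stalled : ∀ {n} → Digraph n → Subset n → Set
Stalled {n} G S = ∀ (x w : Fin n) → ¬ CanForce G S x w

-- F (listed in some valid performance order) is a set of forces of B.
IsForcesOf : ∀ {n} → Digraph n → Subset n → List (Force n) → Set
IsForcesOf G B F = ValidSeq G B F × Stalled G (perform B F)

Stage : ∀ {n} → Digraph n → Subset n → List (Force n) → ℕ → Fin n → Set
Stage G B F zero w = w ∈ B
Stage {n} G B F (suc t) w =
  Stage G B F t w ⊎
  (¬ Stage G B F t w ×
   ∃[ x ] ((x , w) ∈ₗ F × Stage G B F t x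
           × (∀ (y : Fin n) → G x y ≡ true → ¬ Stage G B F t y → y ≡ w)))

Full : ∀ {n} → Digraph n → Subset n → List (Force n) → ℕ → Set
Full {n} G B F t = ∀ (w : Fin n) → Stage G B F t w

-- pt(Γ; F) = t (finite); pt(Γ;F) = ∞ iff no t satisfies this.
PtF : ∀ {n} → Digraph n → Subset n → List (Force n) → ℕ → Set
PtF G B F t = Full G B F t × (∀ s → s < t → ¬ Full G B F s)

PtB : ∀ {n} → Digraph n → Subset n → ℕ → Set
PtB {n} G B t =
  (∃[ F ] (IsForcesOf G B F × PtF G B F t))
  × (∀ (F : List (Force n)) s → IsForcesOf G B F → PtF G B F s → t ≤ s)

-- th(Γ) = t : the minimum of |B| + pt(Γ;B) over B ⊆ V (pt = ∞ terms excluded).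
IsThrottling : ∀ {n} → Digraph n → ℕ → Set
IsThrottling {n} G t =
  (∃[ B ] ∃[ p ] (PtB G B p × ∣ B ∣ + p ≡ t))
  × (∀ (B : Subset n) p → PtB G B p → t ≤ ∣ B ∣ + p)

module Submission where

-- Fix a set B and a set of forces F of B in G (listed in performance order)
-- colouring everything by time p, with |B| + p = th(G).  We build a set B₀ with
-- |B₀| ≤ |B| and a set of forces F₀ of B₀ in G₀ that colours everything by time
-- p; the general bound th-bound then gives th(G₀) ≤ |B₀| + p ≤ th(G).
--   * If u → v is not a force of F, take B₀ = B and F₀ = F: every forcer differs
--     from the sink v, and out of such vertices G₀ only lacks the arc (u,v), so
--     the forces stay valid and the stages can only grow (stage-mono).
--   * If F = F₁ ++ (u → v) ∷ F₂, the source u lies in B; take B₀ = B with u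
--     exchanged for v and F₀ = F₁ ++ (v → u) ∷ F₂.  Every vertex other than u
--     is coloured in G₀ no later than in G, and u is coloured by time 1.
-- The file first develops generic facts about subsets, force sequences, stages
-- and the throttling number, then the two cases inside the module ArcReversal.

open import Defs
open import Data.Nat using (ℕ; zero; suc; _+_; _≤_; _<_; s≤s; z≤n; _≤?_)
open import Data.Nat.Properties
  using (≤-refl; ≤-trans; ≮⇒≥; +-monoʳ-≤; +-monoˡ-≤; +-suc; +-comm; module ≤-Reasoning)
open import Data.Nat.Induction using (<-rec)
open import Data.Fin using (Fin; _≟_)
open import Data.Fin.Subset using (Subset; _∈_; _∉_; _∪_; _─_; _-_; ⁅_⁆; ∣_∣; inside; outside)
open import Data.Fin.Subset.Properties
  using (x∈p∪q⁺; x∈p∪q⁻; x∈⁅x⁆; x∈⁅y⁆⇒x≡y; ∣p∣≤∣x∷p∣; ∣⁅x⁆∣≡1; p─q⊆p;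
         x∈p∧x≢y⇒x∈p-y; x∈p⇒∣p-x∣<∣p∣; ⊆-antisym)
  renaming (_∈?_ to _∈ˢ?_)
open import Data.Fin.Properties using (any?; all?)
open import Data.Bool using (true)
import Data.Bool as Bool
open import Data.Vec using (_∷_; [])
import Data.Vec as Vec
open import Data.List using (List; []; _∷_; _++_)
open import Data.List.Relation.Unary.Any using (here; there)
open import Data.List.Membership.Propositional using () renaming (_∈_ to _∈ₗ_; _∉_ to _∉ₗ_)
open import Data.List.Membership.Propositional.Properties using (∈-++⁺ˡ; ∈-++⁺ʳ; ∈-++⁻; ∈-∃++)
import Data.List.Membership.DecPropositional as DecMembership
open import Data.Product using (_×_; _,_; ∃-syntax; proj₁)
open import Data.Product.Properties using (≡-dec)
open import Data.Sum using (_⊎_; inj₁; inj₂)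
open import Data.Unit using (tt)
open import Data.Empty using (⊥-elim)
open import Function using (_∘_)
open import Relation.Nullary using (¬_; Dec; yes; no; contradiction)
open import Relation.Nullary.Decidable using (_⊎-dec_; _×-dec_; _→-dec_; ¬?; decidable-stable; dec-false; dec-true)
open import Relation.Binary.PropositionalEquality using (_≡_; _≢_; refl; sym; trans; cong; subst)

private
  variable
    n : ℕ

x∈p─q⇒x∉q : ∀ (p q : Subset n) {x} → x ∈ p ─ q → x ∉ q
x∈p─q⇒x∉q (_ ∷ p) (outside ∷ q) Vec.here ()
x∈p─q⇒x∉q (_ ∷ p) (inside ∷ q) () Vec.here
x∈p─q⇒x∉q (_ ∷ p) (_ ∷ q) (Vec.there x∈p─q) (Vec.there x∈q) = x∈p─q⇒x∉q p q x∈p─q x∈q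

∣p∪q∣≤∣p∣+∣q∣ : ∀ (p q : Subset n) → ∣ p ∪ q ∣ ≤ ∣ p ∣ + ∣ q ∣
∣p∪q∣≤∣p∣+∣q∣ [] [] = z≤n
∣p∪q∣≤∣p∣+∣q∣ (inside ∷ p) (t ∷ q) = s≤s (≤-trans (∣p∪q∣≤∣p∣+∣q∣ p q) (+-monoʳ-≤ ∣ p ∣ (∣p∣≤∣x∷p∣ t q)))
∣p∪q∣≤∣p∣+∣q∣ (outside ∷ p) (inside ∷ q) rewrite +-suc ∣ p ∣ ∣ q ∣ = s≤s (∣p∪q∣≤∣p∣+∣q∣ p q)
∣p∪q∣≤∣p∣+∣q∣ (outside ∷ p) (outside ∷ q) = ∣p∪q∣≤∣p∣+∣q∣ p q

∈-∪⁅⁆⁻ : ∀ {S : Subset n} {w y} → y ∈ S ∪ ⁅ w ⁆ → y ∈ S ⊎ y ≡ w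
∈-∪⁅⁆⁻ {S = S} {w} m with x∈p∪q⁻ S ⁅ w ⁆ m
... | inj₁ y∈S = inj₁ y∈S
... | inj₂ y∈w = inj₂ (x∈⁅y⁆⇒x≡y w y∈w)

∈-∪⁅⁆⁺ : ∀ {S : Subset n} {w y} → y ∈ S ⊎ y ≡ w → y ∈ S ∪ ⁅ w ⁆
∈-∪⁅⁆⁺ (inj₁ y∈S) = x∈p∪q⁺ (inj₁ y∈S)
∈-∪⁅⁆⁺ {w = w} (inj₂ refl) = x∈p∪q⁺ (inj₂ (x∈⁅x⁆ w))

in-arc⇒≢source : ∀ {H : Digraph n} {u x w} → Source H u → H x w ≡ true → w ≢ u
in-arc⇒≢source src arc refl = contradiction (trans (sym (src _)) arc) λ ()

out-arc⇒≢sink : ∀ {H : Digraph n} {v x w} → Sink H v → H x w ≡ true → x ≢ v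
out-arc⇒≢sink snk arc refl = contradiction (trans (sym (snk _)) arc) λ ()

module _ {H : Digraph n} where

  validSeq-++⁻ : ∀ {S} F₁ {F₂} → ValidSeq H S (F₁ ++ F₂) → ValidSeq H S F₁ × ValidSeq H (perform S F₁) F₂
  validSeq-++⁻ [] valid = tt , valid
  validSeq-++⁻ ((x , w) ∷ F₁) (cf , valid) =
    let (valid₁ , valid₂) = validSeq-++⁻ F₁ valid in (cf , valid₁) , valid₂

  validSeq-++⁺ : ∀ {S} F₁ {F₂} → ValidSeq H S F₁ → ValidSeq H (perform S F₁) F₂ → ValidSeq H S (F₁ ++ F₂)
  validSeq-++⁺ [] _ valid₂ = valid₂
  validSeq-++⁺ ((x , w) ∷ F₁) (cf , valid₁) valid₂ = cf , validSeq-++⁺ F₁ valid₁ valid₂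

  forced-arc : ∀ {S F x w} → ValidSeq H S F → (x , w) ∈ₗ F → H x w ≡ true
  forced-arc ((_ , _ , arc , _) , _) (here refl) = arc
  forced-arc (_ , valid) (there m) = forced-arc valid m

  forced-fresh : ∀ {S F x w} → ValidSeq H S F → (x , w) ∈ₗ F → w ∉ S
  forced-fresh ((_ , w∉S , _) , _) (here refl) = w∉S
  forced-fresh (_ , valid) (there m) w∈S = forced-fresh valid m (∈-∪⁅⁆⁺ (inj₁ w∈S))

perform-⊇ : ∀ {S : Subset n} F {y} → y ∈ S → y ∈ perform S F
perform-⊇ [] y∈S = y∈S
perform-⊇ ((x , w) ∷ F) y∈S = perform-⊇ F (∈-∪⁅⁆⁺ (inj₁ y∈S))

perform-target : ∀ {S : Subset n} F {x y} → (x , y) ∈ₗ F → y ∈ perform S F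
perform-target ((x , w) ∷ F) (here refl) = perform-⊇ F (∈-∪⁅⁆⁺ (inj₂ refl))
perform-target ((x , w) ∷ F) (there m) = perform-target F m

_≟ᶠ_ : (f g : Force n) → Dec (f ≡ g)
_≟ᶠ_ = ≡-dec _≟_ _≟_

_∈ₗ?_ : (f : Force n) (F : List (Force n)) → Dec (f ∈ₗ F)
_∈ₗ?_ = DecMembership._∈?_ _≟ᶠ_

-- Membership in a stage is decidable (all quantifiers range over Fin n).
stage? : (H : Digraph n) (B : Subset n) (F : List (Force n)) → ∀ t w → Dec (Stage H B F t w)
stage? H B F zero w = w ∈ˢ? B
stage? H B F (suc t) w =
  stage? H B F t w ⊎-dec
  (¬? (stage? H B F t w) ×-dec
    any? (λ x → ((x , w) ∈ₗ? F) ×-dec stage? H B F t x ×-dec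
      all? (λ y → (H x y Bool.≟ true) →-dec (¬? (stage? H B F t y) →-dec (y ≟ w)))))

stage-origin : ∀ {H : Digraph n} {B F} t {y} → Stage H B F t y → y ∈ B ⊎ ∃[ x ] ((x , y) ∈ₗ F)
stage-origin zero y∈B = inj₁ y∈B
stage-origin (suc t) (inj₁ s) = stage-origin t s
stage-origin (suc t) (inj₂ (_ , x , m , _)) = inj₂ (x , m)

source-initial : ∀ {H : Digraph n} {B F u} t → Source H u → ValidSeq H B F → Stage H B F t u → u ∈ B
source-initial {H = H} t src valid s with stage-origin t s
... | inj₁ u∈B = u∈B
... | inj₂ (x , m) = ⊥-elim (in-arc⇒≢source {H = H} src (forced-arc valid m) refl)

full⇒stalled : ∀ {H : Digraph n} {B F} t → Full H B F t → Stalled H (perform B F)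
full⇒stalled {F = F} t full x w (_ , w∉ , _) with stage-origin t (full w)
... | inj₁ w∈B = w∉ (perform-⊇ F w∈B)
... | inj₂ (_ , m) = w∉ (perform-target F m)

stage-mono : ∀ {H H' : Digraph n} {B F} →
  (∀ {x w y} → (x , w) ∈ₗ F → H' x y ≡ true → H x y ≡ true) →
  ∀ t {y} → Stage H B F t y → Stage H' B F t y
stage-mono sub zero s = s
stage-mono sub (suc t) (inj₁ s) = inj₁ (stage-mono sub t s)
stage-mono {H' = H'} {B} {F} sub (suc t) {y} (inj₂ (_ , x , m , sx , unique)) with stage? H' B F t y
... | yes s = inj₁ s
... | no ns = inj₂ (ns , x , m , stage-mono sub t sx ,
                    λ z arc z∉ → unique z (sub m arc) (z∉ ∘ stage-mono sub t))

Completes : Digraph n → Subset n → ℕ → Set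
Completes H B s = ∃[ F ] (ValidSeq H B F × Full H B F s)

¬¬-least : (P : ℕ → Set) → ∀ k → P k → ¬ ¬ (∃[ s ] (P s × (∀ s' → s' < s → ¬ P s')))
¬¬-least P k pk noLeast = <-rec (λ k → ¬ P k) (λ k below pk → noLeast (k , pk , λ s' lt → below lt)) k pk

least-completion⇒PtB : ∀ {H : Digraph n} {B s} → Completes H B s →
  (∀ s' → s' < s → ¬ Completes H B s') → PtB H B s
least-completion⇒PtB {s = s} (F , valid , full) minimal =
  (F , (valid , full⇒stalled s full) , full , λ s' lt full' → minimal s' lt (F , valid , full')) ,
  λ F' s' (valid' , _) (full' , _) → ≮⇒≥ λ lt → minimal s' lt (F' , valid' , full')

th-bound : ∀ {H : Digraph n} {t₀ B k} → IsThrottling H t₀ → Completes H B k → t₀ ≤ ∣ B ∣ + k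
th-bound {H = H} {t₀} {B} {k} (_ , optimal) completes =
  decidable-stable (t₀ ≤? ∣ B ∣ + k) λ t₀≰ →
    ¬¬-least (Completes H B) k completes λ (s , completes-s , minimal) →
      t₀≰ (≤-trans (optimal B s (least-completion⇒PtB completes-s minimal))
                   (+-monoʳ-≤ ∣ B ∣ (≮⇒≥ λ k<s → minimal k k<s completes)))

module ArcReversal (G : Digraph n) (u v : Fin n) (oriented : Oriented G)
  (uv : G u v ≡ true) (source : Source G u) (sink : Sink G v) where

  G₀ : Digraph n
  G₀ = reverseArc G u v

  u≢v : u ≢ v
  u≢v refl = contradiction (trans (sym (proj₁ oriented u)) uv) λ ()

  head≢u : ∀ {x w} → G x w ≡ true → w ≢ u
  head≢u = in-arc⇒≢source {H = G} source

  tail≢v : ∀ {x w} → G x w ≡ true → x ≢ v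
  tail≢v = out-arc⇒≢sink {H = G} sink

  G₀-agrees : ∀ x y → x ≢ v → ¬ (x ≡ u × y ≡ v) → G₀ x y ≡ G x y
  G₀-agrees x y x≢v not-uv rewrite dec-false (x ≟ v) x≢v with x ≟ u | y ≟ v
  ... | yes x≡u | yes y≡v = ⊥-elim (not-uv (x≡u , y≡v))
  ... | yes _ | no _ = refl
  ... | no _ | _ = refl

  G₀-sub : ∀ x y → x ≢ v → G₀ x y ≡ true → G x y ≡ true
  G₀-sub x y x≢v arc with (x ≟ u) ×-dec (y ≟ v)
  ... | yes (refl , refl) = uv
  ... | no not-uv = trans (sym (G₀-agrees x y x≢v not-uv)) arc

  G₀-vu : G₀ v u ≡ true
  G₀-vu rewrite dec-false (v ≟ u) (u≢v ∘ sym) | dec-true (v ≟ v) refl | dec-true (u ≟ u) refl = refl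

  G₀-from-v : ∀ y → G₀ v y ≡ true → y ≡ u
  G₀-from-v y arc rewrite dec-false (v ≟ u) (u≢v ∘ sym) | dec-true (v ≟ v) refl with y ≟ u
  ... | yes y≡u = y≡u
  ... | no _ = contradiction (trans (sym (sink y)) arc) λ ()

  force-kept : ∀ {S x w} → ¬ (x ≡ u × w ≡ v) → CanForce G S x w → CanForce G₀ S x w
  force-kept {x = x} {w} not-uv (x∈S , w∉S , arc , unique) =
    x∈S , w∉S , trans (G₀-agrees x w x≢v not-uv) arc , λ y arc₀ → unique y (G₀-sub x y x≢v arc₀)
    where x≢v = tail≢v arc

  valid-kept : ∀ {S} F → (u , v) ∉ₗ F → ValidSeq G S F → ValidSeq G₀ S F
  valid-kept [] _ _ = tt
  valid-kept ((x , w) ∷ F) uv∉F (cf , valid) =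
    force-kept (λ { (refl , refl) → uv∉F (here refl) }) cf , valid-kept F (uv∉F ∘ there) valid

  unused-arc : ∀ {B F p} → (u , v) ∉ₗ F → ValidSeq G B F → Full G B F p → Completes G₀ B p
  unused-arc {F = F} {p} uv∉F valid full =
    F , valid-kept F uv∉F valid ,
    λ y → stage-mono (λ {x} {_} {z} m → G₀-sub x z (tail≢v (forced-arc valid m))) p (full y)

  exchange : Subset n → Subset n
  exchange S = (S - u) ∪ ⁅ v ⁆

  ∈-exchange⁻ : ∀ {S y} → y ∈ exchange S → (y ∈ S × y ≢ u) ⊎ y ≡ v
  ∈-exchange⁻ {S} m with x∈p∪q⁻ (S - u) ⁅ v ⁆ m
  ... | inj₁ y∈S-u = inj₁ (p─q⊆p S ⁅ u ⁆ y∈S-u , λ { refl → x∈p─q⇒x∉q S ⁅ u ⁆ y∈S-u (x∈⁅x⁆ u) })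
  ... | inj₂ y∈v = inj₂ (x∈⁅y⁆⇒x≡y v y∈v)

  ∈-exchange⁺ : ∀ {S y} → y ∈ S → y ≢ u → y ∈ exchange S
  ∈-exchange⁺ y∈S y≢u = x∈p∪q⁺ (inj₁ (x∈p∧x≢y⇒x∈p-y y∈S y≢u))

  v∈exchange : ∀ {S} → v ∈ exchange S
  v∈exchange = x∈p∪q⁺ (inj₂ (x∈⁅x⁆ v))

  u∉exchange : ∀ {S} → u ∉ exchange S
  u∉exchange m with ∈-exchange⁻ m
  ... | inj₁ (_ , u≢u) = u≢u refl
  ... | inj₂ u≡v = u≢v u≡v

  ∣exchange∣≤ : ∀ {S} → u ∈ S → ∣ exchange S ∣ ≤ ∣ S ∣
  ∣exchange∣≤ {S} u∈S = begin
    ∣ (S - u) ∪ ⁅ v ⁆ ∣    ≤⟨ ∣p∪q∣≤∣p∣+∣q∣ (S - u) ⁅ v ⁆ ⟩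
    ∣ S - u ∣ + ∣ ⁅ v ⁆ ∣  ≡⟨ cong (∣ S - u ∣ +_) (∣⁅x⁆∣≡1 v) ⟩
    ∣ S - u ∣ + 1          ≡⟨ +-comm ∣ S - u ∣ 1 ⟩
    suc ∣ S - u ∣          ≤⟨ x∈p⇒∣p-x∣<∣p∣ u∈S ⟩
    ∣ S ∣                  ∎
    where open ≤-Reasoning

  exchange-∪ : ∀ {S w} → w ≢ u → exchange S ∪ ⁅ w ⁆ ≡ exchange (S ∪ ⁅ w ⁆)
  exchange-∪ {S} {w} w≢u = ⊆-antisym to from
    where
    to : ∀ {y} → y ∈ exchange S ∪ ⁅ w ⁆ → y ∈ exchange (S ∪ ⁅ w ⁆)
    to m with ∈-∪⁅⁆⁻ m
    ... | inj₂ refl = ∈-exchange⁺ (∈-∪⁅⁆⁺ (inj₂ refl)) w≢u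
    ... | inj₁ m' with ∈-exchange⁻ m'
    ...   | inj₁ (y∈S , y≢u) = ∈-exchange⁺ (∈-∪⁅⁆⁺ (inj₁ y∈S)) y≢u
    ...   | inj₂ refl = v∈exchange
    from : ∀ {y} → y ∈ exchange (S ∪ ⁅ w ⁆) → y ∈ exchange S ∪ ⁅ w ⁆
    from m with ∈-exchange⁻ m
    ... | inj₂ refl = ∈-∪⁅⁆⁺ (inj₁ v∈exchange)
    ... | inj₁ (m' , y≢u) with ∈-∪⁅⁆⁻ m'
    ...   | inj₁ y∈S = ∈-∪⁅⁆⁺ (inj₁ (∈-exchange⁺ y∈S y≢u))
    ...   | inj₂ refl = ∈-∪⁅⁆⁺ (inj₂ refl)

  -- After v → u in G₀ and u → v in G, the two blue sets coincide again.
  exchange-∪-u : ∀ {S} → u ∈ S → exchange S ∪ ⁅ u ⁆ ≡ S ∪ ⁅ v ⁆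
  exchange-∪-u {S} u∈S = ⊆-antisym to from
    where
    to : ∀ {y} → y ∈ exchange S ∪ ⁅ u ⁆ → y ∈ S ∪ ⁅ v ⁆
    to m with ∈-∪⁅⁆⁻ m
    ... | inj₂ refl = ∈-∪⁅⁆⁺ (inj₁ u∈S)
    ... | inj₁ m' with ∈-exchange⁻ m'
    ...   | inj₁ (y∈S , _) = ∈-∪⁅⁆⁺ (inj₁ y∈S)
    ...   | inj₂ y≡v = ∈-∪⁅⁆⁺ (inj₂ y≡v)
    from : ∀ {y} → y ∈ S ∪ ⁅ v ⁆ → y ∈ exchange S ∪ ⁅ u ⁆
    from {y} m with ∈-∪⁅⁆⁻ m | y ≟ u
    ... | _ | yes y≡u = ∈-∪⁅⁆⁺ (inj₂ y≡u)
    ... | inj₁ y∈S | no y≢u = ∈-∪⁅⁆⁺ (inj₁ (∈-exchange⁺ y∈S y≢u))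
    ... | inj₂ refl | no _ = ∈-∪⁅⁆⁺ (inj₁ v∈exchange)

  -- While v is still white, no force is made by u, so forces survive the exchange.
  force-exchanged : ∀ {S x w} → v ∉ S → w ≢ v → CanForce G S x w → CanForce G₀ (exchange S) x w
  force-exchanged {S} {x} {w} v∉S w≢v (x∈S , w∉S , arc , unique) =
    ∈-exchange⁺ x∈S x≢u , w∉exchange , trans (G₀-agrees x w x≢v λ (x≡u , _) → x≢u x≡u) arc , unique₀
    where
    x≢v = tail≢v arc
    x≢u : x ≢ u
    x≢u refl = w≢v (sym (unique v uv v∉S))
    w∉exchange : w ∉ exchange S
    w∉exchange m with ∈-exchange⁻ m
    ... | inj₁ (w∈S , _) = w∉S w∈S
    ... | inj₂ w≡v = w≢v w≡v
    unique₀ : ∀ y → G₀ x y ≡ true → y ∉ exchange S → y ≡ w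
    unique₀ y arc₀ y∉ = unique y arcG (y∉ ∘ λ y∈S → ∈-exchange⁺ y∈S (head≢u arcG))
      where arcG = G₀-sub x y x≢v arc₀

  valid-exchanged : ∀ {S} F → v ∉ perform S F → ValidSeq G S F →
    ValidSeq G₀ (exchange S) F × perform (exchange S) F ≡ exchange (perform S F)
  valid-exchanged [] _ _ = tt , refl
  valid-exchanged {S} ((x , w) ∷ F) v∉ (cf@(_ , _ , arc , _) , valid) =
    let (valid₀ , same) = valid-exchanged F v∉ valid in
    (force-exchanged v∉S w≢v cf , subst (λ T → ValidSeq G₀ T F) (sym ∪-comm) valid₀) ,
    trans (cong (λ T → perform T F) ∪-comm) same
    where
    v∉S : v ∉ S
    v∉S = v∉ ∘ perform-⊇ F ∘ ∈-∪⁅⁆⁺ ∘ inj₁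
    w≢v : w ≢ v
    w≢v refl = v∉ (perform-⊇ F (∈-∪⁅⁆⁺ (inj₂ refl)))
    ∪-comm : exchange S ∪ ⁅ w ⁆ ≡ exchange (S ∪ ⁅ w ⁆)
    ∪-comm = exchange-∪ (head≢u arc)

  module UsedArc (B : Subset n) (F₁ F₂ : List (Force n))
    (valid : ValidSeq G B (F₁ ++ (u , v) ∷ F₂)) where

    F F₀ : List (Force n)
    F = F₁ ++ (u , v) ∷ F₂
    F₀ = F₁ ++ (v , u) ∷ F₂

    B₀ : Subset n
    B₀ = exchange B

    v∉B : v ∉ B
    v∉B = forced-fresh valid (∈-++⁺ʳ F₁ (here refl))

    -- Split at u → v: exchange during F₁, swap the middle force, keep F₂.
    valid₀ : ValidSeq G₀ B₀ F₀
    valid₀ =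
      let (valid₁ , u→v@(u∈S₁ , v∉S₁ , _) , valid₂) = validSeq-++⁻ F₁ valid
          (valid₁₀ , same) = valid-exchanged F₁ v∉S₁ valid₁
          v→u = v∈exchange , u∉exchange , G₀-vu , λ y arc _ → G₀-from-v y arc
          valid₂₀ = valid-kept F₂ (λ m → forced-fresh valid₂ m (∈-∪⁅⁆⁺ (inj₂ refl))) valid₂
      in validSeq-++⁺ F₁ valid₁₀
           (subst (λ S → ValidSeq G₀ S ((v , u) ∷ F₂)) (sym same)
             (v→u , subst (λ S → ValidSeq G₀ S F₂) (sym (exchange-∪-u u∈S₁)) valid₂₀))

    Stage₁ Stage₀ : ℕ → Fin n → Set
    Stage₁ = Stage G B F
    Stage₀ = Stage G₀ B₀ F₀

    v-initial : ∀ t → Stage₀ t v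
    v-initial zero = v∈exchange
    v-initial (suc t) = inj₁ (v-initial t)

    -- The force v → u colours u in the first round.
    u-after-first : ∀ t → Stage₀ (suc t) u
    u-after-first t with stage? G₀ B₀ F₀ t u
    ... | yes s = inj₁ s
    ... | no ns = inj₂ (ns , v , ∈-++⁺ʳ F₁ (here refl) , v-initial t , λ y arc _ → G₀-from-v y arc)

    force-in-F₀ : ∀ {x y} → (x , y) ∈ₗ F → y ≢ v → (x , y) ∈ₗ F₀
    force-in-F₀ m y≢v with ∈-++⁻ F₁ m
    ... | inj₁ m₁ = ∈-++⁺ˡ m₁
    ... | inj₂ (here refl) = ⊥-elim (y≢v refl)
    ... | inj₂ (there m₂) = ∈-++⁺ʳ F₁ (there m₂)

    -- A vertex forcing y ≠ v in round t + 1 in G is blue at time t in G₀: if it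
    -- is u, then t > 0, since at time 0 u still has the white out-neighbour v.
    forcer-coloured : ∀ t {x y} → (∀ {z} → z ≢ u → Stage₁ t z → Stage₀ t z) →
      Stage₁ t x → (∀ z → G x z ≡ true → ¬ Stage₁ t z → z ≡ y) → y ≢ v → Stage₀ t x
    forcer-coloured t {x} earlier sx unique y≢v with x ≟ u | t
    ... | no x≢u | _ = earlier x≢u sx
    ... | yes refl | zero = ⊥-elim (y≢v (sym (unique v uv v∉B)))
    ... | yes refl | suc t' = u-after-first t'

    coloured-earlier : ∀ t {y} → y ≢ u → Stage₁ t y → Stage₀ t y
    coloured-earlier zero y≢u y∈B = ∈-exchange⁺ y∈B y≢u
    coloured-earlier (suc t) y≢u (inj₁ s) = inj₁ (coloured-earlier t y≢u s)
    coloured-earlier (suc t) {y} y≢u (inj₂ (_ , x , m , sx , unique)) with y ≟ v | stage? G₀ B₀ F₀ t y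
    ... | yes refl | _ = v-initial (suc t)
    ... | no _ | yes s = inj₁ s
    ... | no y≢v | no ns =
      inj₂ (ns , x , force-in-F₀ m y≢v , forcer-coloured t (coloured-earlier t) sx unique y≢v ,
            λ z arc₀ z∉ → unique z (arcG z arc₀) (z∉ ∘ coloured-earlier t (head≢u (arcG z arc₀))))
      where
      arcG : ∀ z → G₀ x z ≡ true → G x z ≡ true
      arcG z = G₀-sub x z (tail≢v (forced-arc valid m))

    full₀ : ∀ p → Full G B F p → Full G₀ B₀ F₀ p
    full₀ p full y with y ≟ u
    full₀ p full y | no y≢u = coloured-earlier p y≢u (full y)
    full₀ zero full y | yes refl = ⊥-elim (v∉B (full v))
    full₀ (suc p) full y | yes refl = u-after-first p

    completes₀ : ∀ {p} → Full G B F p → Completes G₀ B₀ p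
    completes₀ {p} full = F₀ , valid₀ , full₀ p full

  completion-transfer : ∀ {B F p} → ValidSeq G B F → Full G B F p →
    ∃[ B₀ ] (∣ B₀ ∣ ≤ ∣ B ∣ × Completes G₀ B₀ p)
  completion-transfer {B} {F} {p} valid full with (u , v) ∈ₗ? F
  ... | no uv∉F = B , ≤-refl , unused-arc uv∉F valid full
  ... | yes uv∈F with ∈-∃++ uv∈F
  ...   | F₁ , F₂ , refl =
    exchange B , ∣exchange∣≤ (source-initial p source valid (full u)) , UsedArc.completes₀ B F₁ F₂ valid full

proposition4p10 : ∀ (n : ℕ) (G : Digraph n) (u v : Fin n) →
    Oriented G → G u v ≡ true → Source G u → Sink G v →
    ∀ (t t₀ : ℕ) → IsThrottling G t → IsThrottling (reverseArc G u v) t₀ →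
    t₀ ≤ t
proposition4p10 n G u v oriented uv source sink t t₀
  ((B , p , ((F , (valid , _) , (full , _)) , _) , refl) , _) throttling₀ =
  let (B₀ , B₀≤B , completes₀) = completion-transfer valid full
  in ≤-trans (th-bound throttling₀ completes₀) (+-monoˡ-≤ p B₀≤B)
  where open ArcReversal G u v oriented uv source sink
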